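{- The family $\mathrm{Fin}_\omega$ (defined in the context) is an ideal on $\sum_{n\ge1}\omega^n$.
   Context: An ideal on a countably infinite set $X$ is a family of subsets of $X$ closed under subsets and finite unions, not containing $X$ and containing all finite subsets of $X$. $\mathrm{Fin}$ is the ideal of finite subsets of $\omega$. For $n\ge1$ the ideal $\mathrm{Fin}^n$ on $\omega^n$ is defined by $\mathrm{Fin}^1=\mathrm{Fin}$ and: $A\subseteq\omega^{n+1}$ is in $\mathrm{Fin}^{n+1}$ iff $\{i\in\omega:\{x\in\omega^n:(i,x)\in A\}\notin\mathrm{Fin}^n\}$ is finite. For $1\le i\le j$ let $\pi_{i,j}:\omega^j\to\omega^i$, $\pi_{i,j}(x_0,\dots,x_{j-1})=(x_{j-i},\dots,x_{j-1})$ (projection onto the last $i$ coordinates). $\mathrm{Fin}_\omega$ is the family of all $M\subseteq\sum_{n\ge1}\omega^n=\{(n,x):n\ge1,x\in\omega^n\}$ for which there are $i\ge1$ and $P\subseteq\omega^i$ with $\omega^i\setminus P\in\mathrm{Fin}^i$ such that $M\cap\{(j,x):j\ge i,\ \pi_{i,j}(x)\in P\}=\emptyset$. -}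

module Defs where

open import Data.Nat using (ℕ; zero; suc; _+_)
open import Data.Vec using (Vec; []; _∷_)
open import Data.List using (List)
open import Data.List.Membership.Propositional using (_∈_)
open import Data.Product using (Σ; ∃-syntax; _×_; _,_)
open import Data.Sum using (_⊎_)
open import Data.Unit using (⊤)
open import Data.Empty using (⊥)
open import Relation.Nullary using (¬_)

IsFinite : {X : Set} → (X → Set) → Set
IsFinite {X} A = ∃[ L ] (∀ (x : X) → A x → x ∈ L)

record IsIdeal {X : Set} (𝓘 : (X → Set) → Set₁) : Set₁ where
  field
    subsetClosed : ∀ (A B : X → Set) → (∀ x → A x → B x) → 𝓘 B → 𝓘 A
    unionClosed  : ∀ (A B : X → Set) → 𝓘 A → 𝓘 B → 𝓘 (λ x → A x ⊎ B x)
    proper       : ¬ 𝓘 (λ _ → ⊤)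
    finiteIn     : ∀ (A : X → Set) → IsFinite A → 𝓘 A

-- ω^(k+1) is represented as Vec ℕ (suc k); FinPow k is the ideal Fin^(k+1).
FinPow : (k : ℕ) → (Vec ℕ (suc k) → Set) → Set
FinPow zero    A = IsFinite (λ (i : ℕ) → A (i ∷ []))
FinPow (suc k) A = IsFinite (λ (i : ℕ) → ¬ FinPow k (λ x → A (i ∷ x)))

-- The index set  Σ_{n≥1} ω^n : pairs (n, x) with x ∈ ω^(n+1) encode (n+1, x).
SumOmega : Set
SumOmega = Σ ℕ (λ n → Vec ℕ (suc n))

-- dropS d k x : drop the first d coordinates of x ∈ ω^(d+k+1),
-- i.e. the projection π_{k+1, d+k+1} onto the last k+1 coordinates.
dropS : (d k : ℕ) → Vec ℕ (suc (d + k)) → Vec ℕ (suc k)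
dropS zero    k x       = x
dropS (suc d) k (_ ∷ x) = dropS d k x

-- Fin_ω : M such that there are i = k+1 ≥ 1 and P ⊆ ω^i with ω^i ∖ P ∈ Fin^i
-- and M ∩ {(j,x) : j ≥ i, π_{i,j}(x) ∈ P} = ∅  (j = d + k + 1 ranges over j ≥ i).
FinOmega : (SumOmega → Set) → Set₁
FinOmega M =
  ∃[ k ] Σ (Vec ℕ (suc k) → Set) (λ P →
    FinPow k (λ x → ¬ P x) ×
    (∀ (d : ℕ) (x : Vec ℕ (suc (d + k))) → M (d + k , x) → P (dropS d k x) → ⊥))

{-# OPTIONS --safe #-}
-- A set lies in Fin_ω when it misses the cylinder over some P ⊆ ω^i whose
-- complement is in Fin^i. The cylinder over P is again co-small one level up,
-- so witnesses can be raised to a common level i and then intersected; this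
-- reduces union closure to that of Fin^i. Properness is inherited from Fin^i,
-- and a finite set misses the cylinder over the complement of its finitely
-- many last coordinates.
module Submission where

open import Defs
open import Data.Nat using (ℕ; zero; suc; _+_; _≟_)
open import Data.Nat.Properties using (+-comm)
open import Data.Vec using (Vec; []; _∷_; last)
open import Data.List using ([]; _++_; map)
open import Data.List.Membership.Propositional using (_∈_; _∉_)
open import Data.List.Membership.Propositional.Properties using (∈-++⁺ˡ; ∈-++⁺ʳ; ∈-map⁺; finite)
open import Data.List.Membership.DecPropositional _≟_ using (_∈?_)
open import Data.Product using (Σ; ∃-syntax; _×_; _,_; proj₂)
open import Data.Sum using (_⊎_; inj₁; inj₂)
open import Data.Unit using (⊤; tt)
open import Data.Empty using (⊥; ⊥-elim)
open import Function using (_∘_; id)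
open import Function.Construct.Identity using (↣-id)
open import Relation.Nullary using (¬_)
open import Relation.Nullary.Negation using (contradiction)
open import Relation.Nullary.Decidable using (decidable-stable)
open import Relation.Binary.PropositionalEquality using (_≡_; refl; sym; subst; cong)

module _ {A B : ℕ → Set} where

  -- List membership is decidable, so a list covering B covers all that is ¬¬-in B.
  IsFinite-¬¬-mono : (∀ i → A i → ¬ ¬ B i) → IsFinite B → IsFinite A
  IsFinite-¬¬-mono A⇒¬¬B (L , B⊆L) =
    L , λ i a → decidable-stable (i ∈? L) (λ i∉L → A⇒¬¬B i a (i∉L ∘ B⊆L i))

  IsFinite-∪ : IsFinite A → IsFinite B → IsFinite (λ i → A i ⊎ B i)
  IsFinite-∪ (L , A⊆L) (K , B⊆K) = L ++ K , λ
    { i (inj₁ a) → ∈-++⁺ˡ (A⊆L i a)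
    ; i (inj₂ b) → ∈-++⁺ʳ L (B⊆K i b)
    }

¬IsFinite-ℕ : ¬ IsFinite {ℕ} (λ _ → ⊤)
¬IsFinite-ℕ (L , ⊆L) = finite (↣-id ℕ) L (λ i → ⊆L i tt)

FinPow-¬¬-mono : ∀ k {A B : Vec ℕ (suc k) → Set} →
                 (∀ x → A x → ¬ ¬ B x) → FinPow k B → FinPow k A
FinPow-¬¬-mono zero    A⇒¬¬B = IsFinite-¬¬-mono (λ i → A⇒¬¬B (i ∷ []))
FinPow-¬¬-mono (suc k) A⇒¬¬B = IsFinite-¬¬-mono λ i ¬FinAᵢ →
  contradiction (¬FinAᵢ ∘ FinPow-¬¬-mono k (λ x → A⇒¬¬B (i ∷ x)))

FinPow-∪ : ∀ k {A B : Vec ℕ (suc k) → Set} →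
           FinPow k A → FinPow k B → FinPow k (λ x → A x ⊎ B x)
FinPow-∪ zero    FinA FinB = IsFinite-∪ FinA FinB
FinPow-∪ (suc k) {A} {B} FinA FinB = IsFinite-¬¬-mono split (IsFinite-∪ FinA FinB)
  where
  split : ∀ i → ¬ FinPow k (λ x → A (i ∷ x) ⊎ B (i ∷ x)) →
          ¬ ¬ (¬ FinPow k (λ x → A (i ∷ x)) ⊎ ¬ FinPow k (λ x → B (i ∷ x)))
  split i ¬Fin∪ neither = neither (inj₁ λ FinAᵢ →
    neither (inj₂ λ FinBᵢ → ¬Fin∪ (FinPow-∪ k FinAᵢ FinBᵢ)))

¬FinPow-full : ∀ k → ¬ FinPow k (λ _ → ⊤)
¬FinPow-full zero    = ¬IsFinite-ℕ
¬FinPow-full (suc k) = ¬IsFinite-ℕ ∘ IsFinite-¬¬-mono (λ _ _ → contradiction (¬FinPow-full k))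

-- Every section of a cylinder is a cylinder one level down, so no index is bad.
FinPow-cylinder : ∀ e k {C : Vec ℕ (suc k) → Set} →
                  FinPow k C → FinPow (e + k) (C ∘ dropS e k)
FinPow-cylinder zero    k FinC = FinC
FinPow-cylinder (suc e) k FinC = [] , λ _ ¬FinCyl → ⊥-elim (¬FinCyl (FinPow-cylinder e k FinC))

dropS-dropS : ∀ d e k (x : Vec ℕ (suc (d + (e + k)))) →
              ∃[ x′ ] (_≡_ {A = SumOmega} (d + (e + k) , x) (d + e + k , x′)
                       × dropS e k (dropS d (e + k) x) ≡ dropS (d + e) k x′)
dropS-dropS zero    e k x       = x , refl , refl
dropS-dropS (suc d) e k (y ∷ x) with dropS-dropS d e k x
... | x′ , pair≡ , drop≡ = y ∷ x′ , cong (λ { (n , v) → suc n , y ∷ v }) pair≡ , drop≡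

last-dropS : ∀ d k (x : Vec ℕ (suc (d + k))) → last (dropS d k x) ≡ last x
last-dropS zero    k x       = refl
last-dropS (suc d) k (y ∷ x) = last-dropS d k x

Avoids : (SumOmega → Set) → (k : ℕ) → (Vec ℕ (suc k) → Set) → Set
Avoids M k P = ∀ d x → M (d + k , x) → P (dropS d k x) → ⊥

-- FinOmega M is definitionally ∃[ k ] FinOmegaAt M k.
FinOmegaAt : (SumOmega → Set) → ℕ → Set₁
FinOmegaAt M k = Σ (Vec ℕ (suc k) → Set) λ P → FinPow k (λ x → ¬ P x) × Avoids M k P

module _ {M : SumOmega → Set} where

  FinOmegaAt-raise : ∀ e {k} → FinOmegaAt M k → FinOmegaAt M (e + k)
  FinOmegaAt-raise e {k} (P , Fin¬P , avoid) = P ∘ dropS e k , FinPow-cylinder e k Fin¬P , avoid′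
    where
    avoid′ : Avoids M (e + k) (P ∘ dropS e k)
    avoid′ d x m p with dropS-dropS d e k x
    ... | x′ , pair≡ , drop≡ = avoid (d + e) x′ (subst M pair≡ m) (subst P drop≡ p)

  FinOmegaAt-⊆ : ∀ {N : SumOmega → Set} {k} → (∀ y → N y → M y) → FinOmegaAt M k → FinOmegaAt N k
  FinOmegaAt-⊆ N⊆M (P , Fin¬P , avoid) = P , Fin¬P , λ d x n → avoid d x (N⊆M _ n)

  FinOmegaAt-finite : IsFinite M → FinOmegaAt M 0
  FinOmegaAt-finite (L , M⊆L) = P , Fin¬P , avoid
    where
    lasts = map (last ∘ proj₂) L
    P : Vec ℕ 1 → Set
    P y = last y ∉ lasts
    Fin¬P : FinPow 0 (λ y → ¬ P y)
    Fin¬P = IsFinite-¬¬-mono (λ _ → id) (lasts , λ _ → id)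
    avoid : Avoids M 0 P
    avoid d x m p = p (subst (_∈ lasts) (sym (last-dropS d 0 x)) (∈-map⁺ _ (M⊆L _ m)))

¬FinOmegaAt-full : ∀ {k} → ¬ FinOmegaAt (λ _ → ⊤) k
¬FinOmegaAt-full {k} (P , Fin¬P , avoid) =
  ¬FinPow-full k (FinPow-¬¬-mono k (λ x _ → contradiction (avoid 0 x tt)) Fin¬P)

FinOmegaAt-∪ : ∀ {A B : SumOmega → Set} {k} →
               FinOmegaAt A k → FinOmegaAt B k → FinOmegaAt (λ y → A y ⊎ B y) k
FinOmegaAt-∪ {A} {B} {k} (P , Fin¬P , avoidA) (Q , Fin¬Q , avoidB) =
  (λ x → P x × Q x) , FinPow-¬¬-mono k ¬both⇒¬¬either (FinPow-∪ k Fin¬P Fin¬Q) , avoid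
  where
  ¬both⇒¬¬either : ∀ x → ¬ (P x × Q x) → ¬ ¬ (¬ P x ⊎ ¬ Q x)
  ¬both⇒¬¬either x ¬pq neither = neither (inj₁ λ p → neither (inj₂ λ q → ¬pq (p , q)))
  avoid : Avoids (λ y → A y ⊎ B y) k (λ x → P x × Q x)
  avoid d x (inj₁ a) (p , _) = avoidA d x a p
  avoid d x (inj₂ b) (_ , q) = avoidB d x b q

corollary3p5 : IsIdeal FinOmega
corollary3p5 = record
  { subsetClosed = λ { A B A⊆B (k , w) → k , FinOmegaAt-⊆ A⊆B w }
  ; unionClosed  = λ { A B (k , wA) (l , wB) →
      l + k , FinOmegaAt-∪ {A} {B} (FinOmegaAt-raise {M = A} l wA)
                                   (subst (FinOmegaAt B) (+-comm k l) (FinOmegaAt-raise {M = B} k wB)) }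
  ; proper       = λ { (k , w) → ¬FinOmegaAt-full w }
  ; finiteIn     = λ { A finA → 0 , FinOmegaAt-finite finA }
  }
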